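{- Let $G^+=(V,E^+)$ be a finite simple undirected graph, $\phi\ge0$, $0\le\eta<1$, and let $\mathcal{C}^*$ be a clustering with $\mathrm{obj}(\mathcal{C}^*)\le\phi$. Consider any execution of Algorithm ClusterPhi$(G^+,\phi,\eta)$. For each $i$, let $C^*_i$ be the cluster of $\mathcal{C}^*$ such that $L_i\cap V_{\mathrm{high}}=C^*_i\cap V_{\mathrm{high}}$. Then for every $i$, $C^*_i\cap N(u_i)\subseteq C_i$.
   Context: For $u\in V$, $N(u)$ is the set of neighbours of $u$ in $G^+$, $\deg(u)=|N(u)|$, and $N[u]=N(u)\cup\{u\}$. $\Delta$ denotes symmetric difference. A clustering $\mathcal{C}$ is a partition of $V$, and $\mathcal{C}_u$ denotes the cluster containing $u$. The disagreement of $u$ is $\rho_{\mathcal{C}}(u)=|N[u]\Delta\mathcal{C}_u|$, and $\mathrm{obj}(\mathcal{C})=\max_u\rho_{\mathcal{C}}(u)$. An $\eta'$-similarity query $\Delta_{\eta'}(u,v,t)$ returns: - $0$ if $|N[u]\Delta N[v]|>(1+\eta')t$; - $1$ if $|N[u]\Delta N[v]|\le t$; - arbitrarily $0$ or $1$ otherwise. Algorithm ClusterPhi$(G^+,\phi,\eta)$, main loop: 1. Let $E'$ be the set of pairs $\{u,v\}$ for which $\Delta_\eta(u,v,2\phi)$ returns $1$. 2. Let $V_{\mathrm{low}}=\{w:\deg(w)\le(3+\eta)\phi\}$ and $V_{\mathrm{high}}=V\setminus V_{\mathrm{low}}$. Set $V_1=V_{\mathrm{low}}$. 3. Let $L_1,\dots,L_k$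 be the connected components of $(V_{\mathrm{high}},E')$, in any order. 4. For $i=1,\dots,k$: - choose any $u_i\in L_i$; - let $R(u_i)=\{w\in V_i\cap N(u_i):\Delta_{\eta/2}(w,u_i,2\phi)\text{ returns }1\}$; - set $C_i=L_i\cup R(u_i)$ and $V_{i+1}=V_i\setminus R(u_i)$.
   Formalization: The parameters φ and η are rational numbers. -}

module Defs where

open import Data.Nat using (ℕ; zero; suc)
open import Data.Bool using (Bool; true; false; not)
open import Data.Fin using (Fin; zero; suc)
open import Data.Fin.Subset using (Subset; _∈_; _∉_; _∩_; _∪_; ∁; ⁅_⁆; ∣_∣)
open import Data.Vec using (tabulate)
open import Data.Integer using (+_)
open import Data.Rational using (ℚ; _/_; _+_; _*_; _≤_; _<_; 1ℚ; ½)
open import Data.Rational.Properties using (_≤?_)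
open import Data.Product using (_×_; Σ; ∃)
open import Relation.Binary.PropositionalEquality using (_≡_; _≢_)
open import Relation.Nullary using (does)
open import Data.Fin using (_≟_)

ℕ→ℚ : ℕ → ℚ
ℕ→ℚ m = (+ m) / 1

record Graph (n : ℕ) : Set where
  field
    adj   : Fin n → Fin n → Bool
    sym   : ∀ u v → adj u v ≡ adj v u
    irref : ∀ u → adj u u ≡ false

module _ {n : ℕ} (G : Graph n) where
  open Graph G

  N : Fin n → Subset n
  N u = tabulate (adj u)

  deg : Fin n → ℕ
  deg u = ∣ N u ∣

  N[_] : Fin n → Subset n
  N[ u ] = N u ∪ ⁅ u ⁆

_Δ_ : ∀ {n} → Subset n → Subset n → Subset n
A Δ B = (A ∩ ∁ B) ∪ (B ∩ ∁ A)

-- A clustering (partition of V) given by a labelling; the cluster of u is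
-- the set of vertices carrying u's label.
Clustering : ℕ → Set
Clustering n = Fin n → Fin n

cluster : ∀ {n} → Clustering n → Fin n → Subset n
cluster 𝒞 u = tabulate (λ w → does (𝒞 w ≟ 𝒞 u))

ρ : ∀ {n} → Graph n → Clustering n → Fin n → ℕ
ρ G 𝒞 u = ∣ N[ G ] u Δ cluster 𝒞 u ∣

-- obj(𝒞) ≤ φ  (obj is the maximum of ρ over V)
objAtMost : ∀ {n} → Graph n → Clustering n → ℚ → Set
objAtMost G 𝒞 φ = ∀ u → ℕ→ℚ (ρ G 𝒞 u) ≤ φ

sd : ∀ {n} → Graph n → Fin n → Fin n → ℕ
sd G u v = ∣ N[ G ] u Δ N[ G ] v ∣

-- q is a valid record of answers of η'-similarity queries Δ_η'(u,v,t)
ValidQuery : ∀ {n} → Graph n → ℚ → ℚ → (Fin n → Fin n → Bool) → Set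
ValidQuery G η' t q = ∀ u v →
  ((1ℚ + η') * t < ℕ→ℚ (sd G u v) → q u v ≡ false) ×
  (ℕ→ℚ (sd G u v) ≤ t → q u v ≡ true)

Vlow : ∀ {n} → Graph n → ℚ → ℚ → Subset n
Vlow G φ η = tabulate (λ w → does (ℕ→ℚ (deg G w) ≤? ((ℕ→ℚ 3 + η) * φ)))

Vhigh : ∀ {n} → Graph n → ℚ → ℚ → Subset n
Vhigh G φ η = ∁ (Vlow G φ η)

data Reach {n} (S : Subset n) (E : Fin n → Fin n → Bool) : Fin n → Fin n → Set where
  here : ∀ {x} → x ∈ S → Reach S E x x
  step : ∀ {x y z} → x ∈ S → E x y ≡ true → Reach S E y z → Reach S E x z

-- L : Fin k → Subset n enumerates (in some order, each exactly once) the
-- connected components of the graph (S, E)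
IsComponentEnumeration : ∀ {n} (S : Subset n) (E : Fin n → Fin n → Bool)
  (k : ℕ) (L : Fin k → Subset n) → Set
IsComponentEnumeration {n} S E k L =
  (∀ i → ∃ λ x → x ∈ L i) ×
  (∀ i x y → x ∈ L i → (y ∈ L i → Reach S E x y) × (Reach S E x y → y ∈ L i)) ×
  (∀ x → x ∈ S → ∃ λ i → x ∈ L i) ×
  (∀ i j x → x ∈ L i → x ∈ L j → i ≡ j)

-- R(u) computed from the current V_i, using answers q₂ w u of Δ_{η/2}(w,u,2φ)
Rset : ∀ {n} → Graph n → (Fin n → Fin n → Bool) → Fin n → Subset n → Subset n
Rset G q₂ u Vi = Vi ∩ (N G u ∩ tabulate (λ w → q₂ w u))

-- V_{i+1} = V_i ∖ R(u_i)
Vstage : ∀ {n k} → Graph n → (Fin n → Fin n → Bool) → (Fin k → Fin n) →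
  Subset n → Fin (suc k) → Subset n
Vstage G q₂ u V₁ zero = V₁
Vstage {k = suc k} G q₂ u V₁ (suc i) =
  Vstage G q₂ (λ j → u (suc j)) (V₁ ∩ ∁ (Rset G q₂ (u zero) V₁)) i

Rstage : ∀ {n k} → Graph n → (Fin n → Fin n → Bool) → (Fin k → Fin n) →
  Subset n → Fin k → Subset n
Rstage G q₂ u V₁ i = Rset G q₂ (u i) (Vstage G q₂ u V₁ (Data.Fin.inject₁ i))

Cstage : ∀ {n k} → Graph n → (Fin n → Fin n → Bool) → (Fin k → Fin n) →
  Subset n → (Fin k → Subset n) → Fin k → Subset n
Cstage G q₂ u V₁ L i = L i ∪ Rstage G q₂ u V₁ i

{-# OPTIONS --safe #-}
-- Let C be the optimal cluster of the centre uᵢ, and w ∈ C ∩ N(uᵢ). If w has high degree it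
-- lies in Lᵢ, since Lᵢ and C agree on V_high. Otherwise w ∈ V₁, and w is within distance
-- ρ(w) + ρ(uᵢ) ≤ 2φ of uᵢ for the metric |N[·] Δ N[·]|, so the test against uᵢ accepts it;
-- it remains to see that no earlier centre uⱼ removed it. Such a uⱼ lies in an optimal
-- cluster C′ disjoint from C, hence
--   deg uᵢ + deg uⱼ ≤ |C| + |C′| + ρ(uᵢ) + ρ(uⱼ) ≤ |C Δ C′| + 2φ
--                   ≤ ρ(w) + |N[w] Δ N[uⱼ]| + ρ(uⱼ) + 2φ,
-- and as both centres have degree above (3 + η)φ this gives |N[w] Δ N[uⱼ]| > (2 + 2η)φ,
-- which is beyond the (1 + η/2)·2φ at which the test may still accept.
module Submission where

open import Defs
open import Data.Nat using (ℕ)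
open import Data.Bool using (Bool; true; false; not; _∧_; _∨_)
open import Data.Fin using (Fin; zero; suc; inject₁; _≟_)
open import Data.Fin.Properties using (<⇒≢)
import Data.Fin as Fin
open import Data.Fin.Subset using (Subset; _∈_; _∉_; _∩_; _∪_; ∁; ⊥; ⁅_⁆; ∣_∣)
open import Data.Fin.Subset.Properties
  using (_∈?_; x∈p∩q⁺; x∈p∩q⁻; x∈p∪q⁺; x∉p⇒x∈∁p; x∈∁p⇒x∉p; ∪-comm; ∣p∣≤∣p∪q∣)
open import Data.Vec using (_∷_; []; tabulate)
open import Data.Vec.Properties using (∷-injective; lookup∘tabulate; []=⇒lookup; lookup⇒[]=)
open import Data.Product using (_,_; proj₁; proj₂)
open import Data.Sum using (inj₁; inj₂)
open import Function using (_∘_)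
open import Relation.Binary.PropositionalEquality
  using (_≡_; refl; sym; trans; cong; cong₂; subst; subst₂)
open import Relation.Nullary using (does; yes; no)
open import Relation.Nullary.Decidable using (dec-true)

∈-tabulate⁺ : ∀ {n} {f : Fin n → Bool} {x} → f x ≡ true → x ∈ tabulate f
∈-tabulate⁺ {f = f} {x} fx≡true = lookup⇒[]= x (tabulate f) (trans (lookup∘tabulate f x) fx≡true)

∈-tabulate⁻ : ∀ {n} {f : Fin n → Bool} {x} → x ∈ tabulate f → f x ≡ true
∈-tabulate⁻ {f = f} {x} x∈f = trans (sym (lookup∘tabulate f x)) ([]=⇒lookup x∈f)

∈-resp-∩≡ : ∀ {n} {p q s : Subset n} {x} → p ∩ s ≡ q ∩ s → x ∈ p → x ∈ s → x ∈ q
∈-resp-∩≡ p∩s≡q∩s x∈p x∈s = proj₁ (x∈p∩q⁻ _ _ (subst (_ ∈_) p∩s≡q∩s (x∈p∩q⁺ (x∈p , x∈s))))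

∈-∪-split : ∀ {n} {p q : Subset n} s {x} → (x ∉ s → x ∈ p) → (x ∈ s → x ∈ q) → x ∈ p ∪ q
∈-∪-split s {x} outside inside with x ∈? s
... | yes x∈s = x∈p∪q⁺ (inj₂ (inside x∈s))
... | no  x∉s = x∈p∪q⁺ (inj₁ (outside x∉s))

module SymmetricDifference where
  open import Data.Nat using (_+_; _≤_; z≤n; s≤s)
  open import Data.Nat.Properties using (+-mono-≤; +-commutativeSemigroup; module ≤-Reasoning)
  open import Algebra.Properties.CommutativeSemigroup +-commutativeSemigroup
    using () renaming (interchange to +-interchange)

  χ : Bool → ℕ
  χ false = 0
  χ true  = 1

  -- (x ∷ p) Δ (y ∷ q) reduces to (x Δᵇ y) ∷ (p Δ q), so each cardinality bound below is a
  -- truth table for the heads plus induction.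
  _Δᵇ_ : Bool → Bool → Bool
  x Δᵇ y = (x ∧ not y) ∨ (y ∧ not x)

  ∣x∷p∣≡χx+∣p∣ : ∀ {n} x (p : Subset n) → ∣ x ∷ p ∣ ≡ χ x + ∣ p ∣
  ∣x∷p∣≡χx+∣p∣ false p = refl
  ∣x∷p∣≡χx+∣p∣ true  p = refl

  ∣x∷p∣≤∣y∷q∣+∣z∷r∣ : ∀ {n} x y z (p q r : Subset n) →
    χ x ≤ χ y + χ z → ∣ p ∣ ≤ ∣ q ∣ + ∣ r ∣ → ∣ x ∷ p ∣ ≤ ∣ y ∷ q ∣ + ∣ z ∷ r ∣
  ∣x∷p∣≤∣y∷q∣+∣z∷r∣ x y z p q r head tail = begin
    ∣ x ∷ p ∣                       ≡⟨ ∣x∷p∣≡χx+∣p∣ x p ⟩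
    χ x + ∣ p ∣                     ≤⟨ +-mono-≤ head tail ⟩
    (χ y + χ z) + (∣ q ∣ + ∣ r ∣)   ≡⟨ +-interchange (χ y) (χ z) (∣ q ∣) (∣ r ∣) ⟩
    (χ y + ∣ q ∣) + (χ z + ∣ r ∣)   ≡⟨ sym (cong₂ _+_ (∣x∷p∣≡χx+∣p∣ y q) (∣x∷p∣≡χx+∣p∣ z r)) ⟩
    ∣ y ∷ q ∣ + ∣ z ∷ r ∣           ∎
    where open ≤-Reasoning

  Δ-comm : ∀ {n} (p q : Subset n) → p Δ q ≡ q Δ p
  Δ-comm p q = ∪-comm (p ∩ ∁ q) (q ∩ ∁ p)

  ∣Δ∣-triangle : ∀ {n} (p q r : Subset n) → ∣ p Δ r ∣ ≤ ∣ p Δ q ∣ + ∣ q Δ r ∣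
  ∣Δ∣-triangle []      []      []      = z≤n
  ∣Δ∣-triangle (x ∷ p) (y ∷ q) (z ∷ r) =
    ∣x∷p∣≤∣y∷q∣+∣z∷r∣ (x Δᵇ z) (x Δᵇ y) (y Δᵇ z) (p Δ r) (p Δ q) (q Δ r)
      (head x y z) (∣Δ∣-triangle p q r)
    where
    head : ∀ x y z → χ (x Δᵇ z) ≤ χ (x Δᵇ y) + χ (y Δᵇ z)
    head false _     false = z≤n
    head true  _     true  = z≤n
    head false false true  = s≤s z≤n
    head false true  true  = s≤s z≤n
    head true  false false = s≤s z≤n
    head true  true  false = s≤s z≤n

  ∣p∣≤∣q∣+∣pΔq∣ : ∀ {n} (p q : Subset n) → ∣ p ∣ ≤ ∣ q ∣ + ∣ p Δ q ∣
  ∣p∣≤∣q∣+∣pΔq∣ []      []      = z≤n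
  ∣p∣≤∣q∣+∣pΔq∣ (x ∷ p) (y ∷ q) =
    ∣x∷p∣≤∣y∷q∣+∣z∷r∣ x y (x Δᵇ y) p q (p Δ q) (head x y) (∣p∣≤∣q∣+∣pΔq∣ p q)
    where
    head : ∀ x y → χ x ≤ χ y + χ (x Δᵇ y)
    head false _     = z≤n
    head true  false = s≤s z≤n
    head true  true  = s≤s z≤n

  ∣p∣+∣q∣≤∣pΔq∣ : ∀ {n} (p q : Subset n) → p ∩ q ≡ ⊥ → ∣ p ∣ + ∣ q ∣ ≤ ∣ p Δ q ∣
  ∣p∣+∣q∣≤∣pΔq∣ []      []      _      = z≤n
  ∣p∣+∣q∣≤∣pΔq∣ (x ∷ p) (y ∷ q) p∩q≡⊥ = begin
    ∣ x ∷ p ∣ + ∣ y ∷ q ∣           ≡⟨ cong₂ _+_ (∣x∷p∣≡χx+∣p∣ x p) (∣x∷p∣≡χx+∣p∣ y q) ⟩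
    (χ x + ∣ p ∣) + (χ y + ∣ q ∣)   ≡⟨ +-interchange (χ x) (∣ p ∣) (χ y) (∣ q ∣) ⟩
    (χ x + χ y) + (∣ p ∣ + ∣ q ∣)   ≤⟨ +-mono-≤ (head x y x∧y≡false) (∣p∣+∣q∣≤∣pΔq∣ p q p∩q≡⊥′) ⟩
    χ (x Δᵇ y) + ∣ p Δ q ∣          ≡⟨ sym (∣x∷p∣≡χx+∣p∣ (x Δᵇ y) (p Δ q)) ⟩
    ∣ (x ∷ p) Δ (y ∷ q) ∣           ∎
    where
    open ≤-Reasoning
    x∧y≡false : x ∧ y ≡ false
    x∧y≡false = proj₁ (∷-injective p∩q≡⊥)
    p∩q≡⊥′ : p ∩ q ≡ ⊥
    p∩q≡⊥′ = proj₂ (∷-injective p∩q≡⊥)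
    head : ∀ x y → x ∧ y ≡ false → χ x + χ y ≤ χ (x Δᵇ y)
    head false false _ = z≤n
    head false true  _ = s≤s z≤n
    head true  false _ = s≤s z≤n

module ClusterGeometry {n} (G : Graph n) (𝒞 : Clustering n) where
  open import Data.Nat using (_+_; _≤_)
  open import Data.Nat.Properties
    using (+-mono-≤; +-monoˡ-≤; +-monoʳ-≤; +-assoc; +-commutativeSemigroup; module ≤-Reasoning)
  open import Algebra.Properties.CommutativeSemigroup +-commutativeSemigroup
    using (x∙yz≈y∙xz) renaming (interchange to +-interchange)
  open import Data.Fin.Subset.Properties using (Empty-unique)
  open SymmetricDifference

  ∈-cluster⁻ : ∀ {w c} → w ∈ cluster 𝒞 c → 𝒞 w ≡ 𝒞 c
  ∈-cluster⁻ {w} {c} w∈C with 𝒞 w ≟ 𝒞 c | ∈-tabulate⁻ {x = w} w∈C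
  ... | yes 𝒞w≡𝒞c | _ = 𝒞w≡𝒞c
  ... | no _       | ()

  ∈-cluster⁺ : ∀ {w c} → 𝒞 w ≡ 𝒞 c → w ∈ cluster 𝒞 c
  ∈-cluster⁺ {w} {c} 𝒞w≡𝒞c = ∈-tabulate⁺ (dec-true (𝒞 w ≟ 𝒞 c) 𝒞w≡𝒞c)

  ρ≡∣N[w]Δcluster∣ : ∀ {w c} → w ∈ cluster 𝒞 c → ρ G 𝒞 w ≡ ∣ N[ G ] w Δ cluster 𝒞 c ∣
  ρ≡∣N[w]Δcluster∣ {w} w∈C =
    cong (λ c → ∣ N[ G ] w Δ tabulate (λ x → does (𝒞 x ≟ c)) ∣) (∈-cluster⁻ w∈C)

  clusters-disjoint : ∀ {c c′} → c′ ∉ cluster 𝒞 c → cluster 𝒞 c ∩ cluster 𝒞 c′ ≡ ⊥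
  clusters-disjoint c′∉C = Empty-unique λ (x , x∈C∩C′) →
    let x∈C , x∈C′ = x∈p∩q⁻ _ _ x∈C∩C′
    in c′∉C (∈-cluster⁺ (trans (sym (∈-cluster⁻ x∈C′)) (∈-cluster⁻ x∈C)))

  deg≤∣N[u]∣ : ∀ u → deg G u ≤ ∣ N[ G ] u ∣
  deg≤∣N[u]∣ u = ∣p∣≤∣p∪q∣ (N G u) ⁅ u ⁆

  sd≤ρ+ρ : ∀ {v w c} → v ∈ cluster 𝒞 c → w ∈ cluster 𝒞 c → sd G v w ≤ ρ G 𝒞 v + ρ G 𝒞 w
  sd≤ρ+ρ {v} {w} {c} v∈C w∈C = begin
    ∣ N[ G ] v Δ N[ G ] w ∣
      ≤⟨ ∣Δ∣-triangle (N[ G ] v) C (N[ G ] w) ⟩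
    ∣ N[ G ] v Δ C ∣ + ∣ C Δ N[ G ] w ∣
      ≡⟨ cong (∣ N[ G ] v Δ C ∣ +_) (cong ∣_∣ (Δ-comm C (N[ G ] w))) ⟩
    ∣ N[ G ] v Δ C ∣ + ∣ N[ G ] w Δ C ∣
      ≡⟨ cong₂ _+_ (ρ≡∣N[w]Δcluster∣ v∈C) (ρ≡∣N[w]Δcluster∣ w∈C) ⟨
    ρ G 𝒞 v + ρ G 𝒞 w
      ∎
    where
    open ≤-Reasoning
    C : Subset n
    C = cluster 𝒞 c

  ∣N[v]∣≤∣C∣+ρ : ∀ {v c} → v ∈ cluster 𝒞 c → ∣ N[ G ] v ∣ ≤ ∣ cluster 𝒞 c ∣ + ρ G 𝒞 v
  ∣N[v]∣≤∣C∣+ρ {v} {c} v∈C =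
    subst (∣ N[ G ] v ∣ ≤_) (cong (∣ cluster 𝒞 c ∣ +_) (sym (ρ≡∣N[w]Δcluster∣ v∈C)))
          (∣p∣≤∣q∣+∣pΔq∣ (N[ G ] v) (cluster 𝒞 c))

  ∣C∣+∣C′∣≤ρ+sd+ρ : ∀ {w v′ c} → w ∈ cluster 𝒞 c → v′ ∉ cluster 𝒞 c →
    ∣ cluster 𝒞 c ∣ + ∣ cluster 𝒞 v′ ∣ ≤ ρ G 𝒞 w + (sd G w v′ + ρ G 𝒞 v′)
  ∣C∣+∣C′∣≤ρ+sd+ρ {w} {v′} {c} w∈C v′∉C = begin
    ∣ C ∣ + ∣ C′ ∣
      ≤⟨ ∣p∣+∣q∣≤∣pΔq∣ C C′ (clusters-disjoint v′∉C) ⟩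
    ∣ C Δ C′ ∣
      ≤⟨ ∣Δ∣-triangle C (N[ G ] w) C′ ⟩
    ∣ C Δ N[ G ] w ∣ + ∣ N[ G ] w Δ C′ ∣
      ≤⟨ +-monoʳ-≤ (∣ C Δ N[ G ] w ∣) (∣Δ∣-triangle (N[ G ] w) (N[ G ] v′) C′) ⟩
    ∣ C Δ N[ G ] w ∣ + (sd G w v′ + ρ G 𝒞 v′)
      ≡⟨ cong (_+ (sd G w v′ + ρ G 𝒞 v′)) ρw≡∣CΔN[w]∣ ⟨
    ρ G 𝒞 w + (sd G w v′ + ρ G 𝒞 v′)
      ∎
    where
    open ≤-Reasoning
    C C′ : Subset n
    C  = cluster 𝒞 c
    C′ = cluster 𝒞 v′
    ρw≡∣CΔN[w]∣ : ρ G 𝒞 w ≡ ∣ C Δ N[ G ] w ∣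
    ρw≡∣CΔN[w]∣ = trans (ρ≡∣N[w]Δcluster∣ w∈C) (cong ∣_∣ (Δ-comm (N[ G ] w) C))

  deg+deg≤sd+ρ : ∀ {v w v′ c} → v ∈ cluster 𝒞 c → w ∈ cluster 𝒞 c → v′ ∉ cluster 𝒞 c →
    deg G v + deg G v′ ≤ sd G w v′ + ((ρ G 𝒞 w + ρ G 𝒞 v′) + (ρ G 𝒞 v + ρ G 𝒞 v′))
  deg+deg≤sd+ρ {v} {w} {v′} {c} v∈C w∈C v′∉C = begin
    deg G v + deg G v′
      ≤⟨ +-mono-≤ (deg≤∣N[u]∣ v) (deg≤∣N[u]∣ v′) ⟩
    ∣ N[ G ] v ∣ + ∣ N[ G ] v′ ∣
      ≤⟨ +-mono-≤ (∣N[v]∣≤∣C∣+ρ v∈C) (∣N[v]∣≤∣C∣+ρ (∈-cluster⁺ refl)) ⟩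
    (∣ C ∣ + ρ𝒞 v) + (∣ C′ ∣ + ρ𝒞 v′)
      ≡⟨ +-interchange (∣ C ∣) (ρ𝒞 v) (∣ C′ ∣) (ρ𝒞 v′) ⟩
    (∣ C ∣ + ∣ C′ ∣) + (ρ𝒞 v + ρ𝒞 v′)
      ≤⟨ +-monoˡ-≤ (ρ𝒞 v + ρ𝒞 v′) (∣C∣+∣C′∣≤ρ+sd+ρ w∈C v′∉C) ⟩
    (ρ𝒞 w + (sd G w v′ + ρ𝒞 v′)) + (ρ𝒞 v + ρ𝒞 v′)
      ≡⟨ cong (_+ (ρ𝒞 v + ρ𝒞 v′)) (x∙yz≈y∙xz (ρ𝒞 w) (sd G w v′) (ρ𝒞 v′)) ⟩
    (sd G w v′ + (ρ𝒞 w + ρ𝒞 v′)) + (ρ𝒞 v + ρ𝒞 v′)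
      ≡⟨ +-assoc (sd G w v′) (ρ𝒞 w + ρ𝒞 v′) (ρ𝒞 v + ρ𝒞 v′) ⟩
    sd G w v′ + ((ρ𝒞 w + ρ𝒞 v′) + (ρ𝒞 v + ρ𝒞 v′))
      ∎
    where
    open ≤-Reasoning
    ρ𝒞 : Fin n → ℕ
    ρ𝒞 = ρ G 𝒞
    C C′ : Subset n
    C  = cluster 𝒞 c
    C′ = cluster 𝒞 v′

open import Data.Integer using (+_)
import Data.Integer as ℤ
import Data.Integer.Properties as ℤ
import Data.Nat as ℕ
import Data.Nat.Coprimality as Coprimality
open import Data.Rational using (ℚ; _≤_; _<_; 0ℚ; 1ℚ; _*_; ½; _+_; -_; _/_; mkℚ; *≤*)
open import Data.Rational.Properties
  using ( +-mono-≤; +-monoʳ-≤; +-mono-<; +-monoˡ-<; +-assoc; +-inverseʳ; +-identityʳ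
        ; ≰⇒>; _≤?_; normalize-coprime; nonNeg*nonNeg⇒nonNeg; nonNegative⁻¹; module ≤-Reasoning)
open import Data.Rational.Base using (nonNegative)
open import Data.Rational.Solver using (module +-*-Solver)

ℕ→ℚ≡mkℚ : ∀ m → ℕ→ℚ m ≡ mkℚ (+ m) 0 (Coprimality.sym (Coprimality.1-coprimeTo m))
ℕ→ℚ≡mkℚ m = normalize-coprime (Coprimality.sym (Coprimality.1-coprimeTo m))

ℕ→ℚ-+ : ∀ m n → ℕ→ℚ (m ℕ.+ n) ≡ ℕ→ℚ m + ℕ→ℚ n
ℕ→ℚ-+ m n rewrite ℕ→ℚ≡mkℚ m | ℕ→ℚ≡mkℚ n =
  cong (_/ 1) (sym (cong₂ ℤ._+_ (ℤ.*-identityʳ (+ m)) (ℤ.*-identityʳ (+ n))))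

ℕ→ℚ-mono-≤ : ∀ {m n} → m ℕ.≤ n → ℕ→ℚ m ≤ ℕ→ℚ n
ℕ→ℚ-mono-≤ {m} {n} m≤n rewrite ℕ→ℚ≡mkℚ m | ℕ→ℚ≡mkℚ n = *≤* (ℤ.*-monoʳ-≤-nonNeg (+ 1) (ℤ.+≤+ m≤n))

ℕ→ℚ-+-≤ : ∀ m n {p q} → ℕ→ℚ m ≤ p → ℕ→ℚ n ≤ q → ℕ→ℚ (m ℕ.+ n) ≤ p + q
ℕ→ℚ-+-≤ m n m≤p n≤q = subst (_≤ _) (sym (ℕ→ℚ-+ m n)) (+-mono-≤ m≤p n≤q)

+-cancelʳ-< : ∀ {p q} r → p + r < q + r → p < q
+-cancelʳ-< {p} {q} r p+r<q+r = subst₂ _<_ (x+r-r≡x p) (x+r-r≡x q) (+-monoˡ-< (- r) p+r<q+r)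
  where
  x+r-r≡x : ∀ x → x + r + - r ≡ x
  x+r-r≡x x = trans (+-assoc x r (- r)) (trans (cong (_+_ x) (+-inverseʳ r)) (+-identityʳ x))

rejection-threshold< : ∀ {φ η a b s r} → 0ℚ ≤ φ → 0ℚ ≤ η →
  (ℕ→ℚ 3 + η) * φ < a → (ℕ→ℚ 3 + η) * φ < b → a + b ≤ s + r → r ≤ (φ + φ) + (φ + φ) →
  (1ℚ + ½ * η) * (ℕ→ℚ 2 * φ) < s
rejection-threshold< {φ} {η} {a} {b} {s} {r} 0≤φ 0≤η T<a T<b a+b≤s+r r≤4φ = +-cancelʳ-< 4φ (begin-strict
  S + 4φ             ≡⟨ +-identityʳ (S + 4φ) ⟨
  S + 4φ + 0ℚ        ≤⟨ +-monoʳ-≤ (S + 4φ) 0≤ηφ ⟩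
  S + 4φ + η * φ     ≡⟨ T+T≡S+4φ+ηφ ⟨
  T + T              <⟨ +-mono-< T<a T<b ⟩
  a + b              ≤⟨ a+b≤s+r ⟩
  s + r              ≤⟨ +-monoʳ-≤ s r≤4φ ⟩
  s + 4φ             ∎)
  where
  open ≤-Reasoning
  open +-*-Solver
  T S 4φ : ℚ
  T  = (ℕ→ℚ 3 + η) * φ
  S  = (1ℚ + ½ * η) * (ℕ→ℚ 2 * φ)
  4φ = (φ + φ) + (φ + φ)
  0≤ηφ : 0ℚ ≤ η * φ
  0≤ηφ = nonNegative⁻¹ (η * φ)
           {{nonNeg*nonNeg⇒nonNeg η {{nonNegative 0≤η}} φ {{nonNegative 0≤φ}}}}
  T+T≡S+4φ+ηφ : T + T ≡ S + 4φ + η * φ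
  T+T≡S+4φ+ηφ = solve 2 (λ φ η →
      (con (ℕ→ℚ 3) :+ η) :* φ :+ (con (ℕ→ℚ 3) :+ η) :* φ
    := (con 1ℚ :+ con ½ :* η) :* (con (ℕ→ℚ 2) :* φ) :+ ((φ :+ φ) :+ (φ :+ φ)) :+ η :* φ) refl φ η

Vhigh⇒threshold<deg : ∀ {n} (G : Graph n) φ η {x} →
  x ∈ Vhigh G φ η → (ℕ→ℚ 3 + η) * φ < ℕ→ℚ (deg G x)
Vhigh⇒threshold<deg G φ η {x} x∈high =
  ≰⇒> λ deg≤T → x∈∁p⇒x∉p x∈high (∈-tabulate⁺ (dec-true (ℕ→ℚ (deg G x) ≤? (ℕ→ℚ 3 + η) * φ) deg≤T))

module SimilarityTest {n} (G : Graph n) (φ η : ℚ) (𝒞 : Clustering n) (obj : objAtMost G 𝒞 φ)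
         (q₂ : Fin n → Fin n → Bool) (q₂-valid : ValidQuery G (½ * η) (ℕ→ℚ 2 * φ) q₂) where
  open ClusterGeometry G 𝒞

  ρ+ρ≤φ+φ : ∀ v w → ℕ→ℚ (ρ G 𝒞 v ℕ.+ ρ G 𝒞 w) ≤ φ + φ
  ρ+ρ≤φ+φ v w = ℕ→ℚ-+-≤ (ρ G 𝒞 v) (ρ G 𝒞 w) (obj v) (obj w)

  accepts-same-cluster : ∀ {v w c} → v ∈ cluster 𝒞 c → w ∈ cluster 𝒞 c → q₂ w v ≡ true
  accepts-same-cluster {v} {w} v∈C w∈C = proj₂ (q₂-valid w v) (begin
    ℕ→ℚ (sd G w v)                 ≤⟨ ℕ→ℚ-mono-≤ (sd≤ρ+ρ w∈C v∈C) ⟩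
    ℕ→ℚ (ρ G 𝒞 w ℕ.+ ρ G 𝒞 v)      ≤⟨ ρ+ρ≤φ+φ w v ⟩
    φ + φ                          ≡⟨ solve 1 (λ φ → φ :+ φ := con (ℕ→ℚ 2) :* φ) refl φ ⟩
    ℕ→ℚ 2 * φ                      ∎)
    where
    open ≤-Reasoning
    open +-*-Solver

  rejects-other-cluster : 0ℚ ≤ φ → 0ℚ ≤ η → ∀ {v w v′ c} →
    v ∈ cluster 𝒞 c → w ∈ cluster 𝒞 c → v′ ∉ cluster 𝒞 c →
    v ∈ Vhigh G φ η → v′ ∈ Vhigh G φ η → q₂ w v′ ≡ false
  rejects-other-cluster 0≤φ 0≤η {v} {w} {v′} v∈C w∈C v′∉C v-high v′-high =
    proj₁ (q₂-valid w v′) (rejection-threshold< 0≤φ 0≤η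
      (Vhigh⇒threshold<deg G φ η v-high) (Vhigh⇒threshold<deg G φ η v′-high)
      (subst₂ _≤_ (ℕ→ℚ-+ (deg G v) (deg G v′)) (ℕ→ℚ-+ (sd G w v′) _)
                  (ℕ→ℚ-mono-≤ (deg+deg≤sd+ρ v∈C w∈C v′∉C)))
      (ℕ→ℚ-+-≤ (ρ G 𝒞 w ℕ.+ ρ G 𝒞 v′) (ρ G 𝒞 v ℕ.+ ρ G 𝒞 v′) (ρ+ρ≤φ+φ w v′) (ρ+ρ≤φ+φ v v′)))

Reach⇒∈ : ∀ {n} {S : Subset n} {E x y} → Reach S E x y → x ∈ S
Reach⇒∈ (here x∈S)       = x∈S
Reach⇒∈ (step x∈S _ _)   = x∈S

component⊆ : ∀ {n} {S : Subset n} {E k L} →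
  IsComponentEnumeration S E k L → ∀ {i x} → x ∈ L i → x ∈ S
component⊆ (_ , reach , _) x∈Lᵢ = Reach⇒∈ (proj₁ (reach _ _ _ x∈Lᵢ) x∈Lᵢ)

∈-Rset⁺ : ∀ {n} (G : Graph n) q₂ u {V w} → w ∈ V → w ∈ N G u → q₂ w u ≡ true → w ∈ Rset G q₂ u V
∈-Rset⁺ G q₂ u w∈V w∈N q₂≡true = x∈p∩q⁺ (w∈V , x∈p∩q⁺ (w∈N , ∈-tabulate⁺ q₂≡true))

∈-Rset⁻ : ∀ {n} (G : Graph n) q₂ u {V w} → w ∈ Rset G q₂ u V → q₂ w u ≡ true
∈-Rset⁻ G q₂ u w∈R = ∈-tabulate⁻ (proj₂ (x∈p∩q⁻ _ _ (proj₂ (x∈p∩q⁻ _ _ w∈R))))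

∈-Vstage : ∀ {n k} (G : Graph n) q₂ (u : Fin k → Fin n) {V₁} i {w} → w ∈ V₁ →
  (∀ j → j Fin.< i → q₂ w (u j) ≡ false) → w ∈ Vstage G q₂ u V₁ (inject₁ i)
∈-Vstage G q₂ u zero    w∈V₁ _        = w∈V₁
∈-Vstage G q₂ u {V₁} (suc i) {w} w∈V₁ rejected =
  ∈-Vstage G q₂ (u ∘ suc) i (x∈p∩q⁺ (w∈V₁ , x∉p⇒x∈∁p w∉R))
    (λ j j<i → rejected (suc j) (ℕ.s≤s j<i))
  where
  w∉R : w ∉ Rset G q₂ (u zero) V₁
  w∉R w∈R with () ← trans (sym (rejected zero (ℕ.s≤s ℕ.z≤n))) (∈-Rset⁻ G q₂ (u zero) w∈R)

mainTheorem6 : ∀ {n} (G : Graph n) (φ η : ℚ) → 0ℚ ≤ φ → 0ℚ ≤ η → η < 1ℚ →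
    (𝒞* : Clustering n) → objAtMost G 𝒞* φ →
    (q₁ : Fin n → Fin n → Bool) → (∀ u v → q₁ u v ≡ q₁ v u) →
    ValidQuery G η (ℕ→ℚ 2 * φ) q₁ →
    (q₂ : Fin n → Fin n → Bool) → ValidQuery G (½ * η) (ℕ→ℚ 2 * φ) q₂ →
    (k : ℕ) (L : Fin k → Subset n) →
    IsComponentEnumeration (Vhigh G φ η) q₁ k L →
    (u : Fin k → Fin n) → (∀ i → u i ∈ L i) →
    ∀ i (c : Fin n) →
    L i ∩ Vhigh G φ η ≡ cluster 𝒞* c ∩ Vhigh G φ η →
    ∀ w → w ∈ cluster 𝒞* c → w ∈ N G (u i) →
    w ∈ Cstage G q₂ u (Vlow G φ η) L i
mainTheorem6 G φ η 0≤φ 0≤η _ 𝒞* obj _ _ _ q₂ q₂-valid _ _ components@(_ , _ , _ , unique)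
             u uⱼ∈Lⱼ i c Lᵢ≡C w w∈C w∈N =
  ∈-∪-split (Vlow G φ η)
    (λ w∉Vlow → ∈-resp-∩≡ (sym Lᵢ≡C) w∈C (x∉p⇒x∈∁p w∉Vlow))
    (λ w∈Vlow → ∈-Rset⁺ G q₂ (u i) (∈-Vstage G q₂ u i w∈Vlow earlier-centres-reject) w∈N
                          (accepts-same-cluster uᵢ∈C w∈C))
  where
  open SimilarityTest G φ η 𝒞* obj q₂ q₂-valid

  centre-high : ∀ j → u j ∈ Vhigh G φ η
  centre-high j = component⊆ components (uⱼ∈Lⱼ j)

  uᵢ∈C : u i ∈ cluster 𝒞* c
  uᵢ∈C = ∈-resp-∩≡ Lᵢ≡C (uⱼ∈Lⱼ i) (centre-high i)

  earlier-centres-reject : ∀ j → j Fin.< i → q₂ w (u j) ≡ false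
  earlier-centres-reject j j<i =
    rejects-other-cluster 0≤φ 0≤η uᵢ∈C w∈C uⱼ∉C (centre-high i) (centre-high j)
    where
    uⱼ∉C : u j ∉ cluster 𝒞* c
    uⱼ∉C uⱼ∈C = <⇒≢ j<i (unique j i (u j) (uⱼ∈Lⱼ j) (∈-resp-∩≡ (sym Lᵢ≡C) uⱼ∈C (centre-high j)))
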